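{- For each odd prime $p$, there is a 1-factor $I$ of $K_{2p}$ such that $K_{2p} - I$ has a factorisation into $\mathrm{Cay}(\mathbb{Z}_{2p}; \pm\{1, 2\})$.
   Context: For a group $G$ and a subset $S \subseteq G$ not containing the identity and closed under inverses, the Cayley graph $\mathrm{Cay}(G;S)$ has vertex set $G$, with $g$ adjacent to $g s$ for each $s \in S$. $\pm\{a_1,\dots,a_s\}$ denotes $\{\pm a_1,\dots,\pm a_s\}$. $K_n - I$ is $K_n$ with the edges of a perfect matching $I$ removed. A factorisation of a graph into $H$ is a decomposition of its edge set into edge-disjoint spanning subgraphs each isomorphic to $H$. -}

module Defs where

open import Data.Nat using (ℕ; _+_; _∸_)
open import Data.Fin using (Fin; toℕ)
open import Data.List using (List; _∷_; [])
open import Data.List.Relation.Unary.Any using (Any)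
open import Data.Product using (Σ; ∃; ∃-syntax; _×_)
open import Data.Sum using (_⊎_)
open import Relation.Nullary using (¬_)
open import Relation.Binary.PropositionalEquality using (_≡_; _≢_)
open import Function.Bundles using (_↔_; Inverse)

Graph : ℕ → Set₁
Graph n = Fin n → Fin n → Set

-- "b ≡ a + s (mod n)" for vertices a b of ℤ_n (represented by Fin n) and 0 ≤ s < n:
-- either a + s = b, or a + s = b + n.
_≡_+_[mod_] : {n : ℕ} → Fin n → Fin n → ℕ → ℕ → Set
b ≡ a + s [mod n ] = (toℕ a + s ≡ toℕ b) ⊎ (toℕ a + s ≡ toℕ b + n)

Cay : (n : ℕ) → List ℕ → Graph n
Cay n S g h = Any (λ s → h ≡ g + s [mod n ]) S

pm12 : ℕ → List ℕ
pm12 n = 1 ∷ 2 ∷ (n ∸ 1) ∷ (n ∸ 2) ∷ []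

record PerfectMatching (n : ℕ) : Set where
  field
    mate       : Fin n → Fin n
    involutive : ∀ x → mate (mate x) ≡ x
    no-fixed   : ∀ x → mate x ≢ x

open PerfectMatching public

KminusI : {n : ℕ} → PerfectMatching n → Graph n
KminusI I x y = (x ≢ y) × (y ≢ mate I x)

_≅_ : {n : ℕ} → Graph n → Graph n → Set
G ≅ H = Σ (Fin _ ↔ Fin _) λ σ →
  ∀ x y → (G x y → H (Inverse.to σ x) (Inverse.to σ y)) × (H (Inverse.to σ x) (Inverse.to σ y) → G x y)

Factorisation : {n : ℕ} → Graph n → Graph n → Set₁
Factorisation {n} G H = ∃[ k ] Σ (Fin k → Graph n) λ F →
    (∀ i → F i ≅ H)
  × (∀ i x y → F i x y → G x y)
  × (∀ x y → G x y → ∃[ i ] F i x y)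
  × (∀ i j x y → F i x y → F j x y → i ≡ j)

-- K_2p − I is Cay(ℤ_2p; ℤ_2p ∖ {0, p}) for the 1-factor I : x ↦ x + p. By parity and size, every
-- d ∈ ℤ_2p ∖ {0, p} is ±c or ±2c for exactly one odd c < p, so the sets ±{c, 2c} (c odd, c < p)
-- partition the connection set. Such c is coprime to 2 and to p, hence a unit of ℤ_2p, and
-- multiplication by c carries Cay(ℤ_2p; ±{1, 2}) isomorphically onto Cay(ℤ_2p; ±{c, 2c}).
module Submission where

open import Defs
open import Data.Nat
open import Data.Nat.Properties
open import Data.Nat.DivMod
open import Data.Nat.Divisibility using (divides; ∣-trans)
open import Data.Nat.Coprimality using (Coprime; coprime-divisor; coprime-Bézout; coprime-+; 1-coprimeTo; prime⇒coprime)
import Data.Nat.Coprimality as Coprimality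
open import Data.Nat.GCD using (module Bézout)
open import Data.Nat.Primality using (Prime; prime⇒irreducible)
open import Data.Nat.Tactic.RingSolver using (solve-∀)
open import Data.Fin using (Fin; toℕ; fromℕ<)
open import Data.Fin.Properties using (toℕ-fromℕ<; toℕ<n; toℕ-injective)
open import Data.List using (List; _∷_; [])
open import Data.List.Relation.Unary.All as All using (All; _∷_; [])
open import Data.List.Relation.Unary.Any using (Any; here; there)
open import Data.List.Relation.Binary.Pointwise using (Pointwise; _∷_; [])
open import Data.List.Membership.Propositional using (_∈_)
open import Data.Product using (∃-syntax; Σ-syntax; _×_; _,_; proj₁; proj₂)
open import Data.Sum using (_⊎_; inj₁; inj₂)
import Data.Sum as Sum
open import Data.Empty using (⊥-elim)
open import Relation.Nullary using (¬_; yes; no; contradiction)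
open import Relation.Binary.PropositionalEquality
open import Function.Bundles using (_⇔_; mk⇔; mk↔ₛ′; Equivalence)
open import Function.Construct.Composition using (_⇔-∘_)
open import Function.Construct.Symmetry using (⇔-sym)

open ≡-Reasoning

2*m≡m+m : ∀ m → 2 * m ≡ m + m
2*m≡m+m m = cong (m +_) (+-identityʳ m)

m+n+[o∸m]≡n+o : ∀ {m o} n → m ≤ o → m + n + (o ∸ m) ≡ n + o
m+n+[o∸m]≡n+o {m} {o} n m≤o = begin
  m + n + (o ∸ m)   ≡⟨ cong (_+ (o ∸ m)) (+-comm m n) ⟩
  n + m + (o ∸ m)   ≡⟨ +-assoc n m (o ∸ m) ⟩
  n + (m + (o ∸ m)) ≡⟨ cong (n +_) (m+[n∸m]≡n m≤o) ⟩
  n + o             ∎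

m+n≡o⇒m≡o∸n : ∀ {m n o} → m + n ≡ o → m ≡ o ∸ n
m+n≡o⇒m≡o∸n {m} {n} e = trans (sym (m+n∸n≡m m n)) (cong (_∸ n) e)

data EvenOdd : ℕ → Set where
  even : ∀ e → EvenOdd (2 * e)
  odd  : ∀ e → EvenOdd (suc (2 * e))

evenOdd : ∀ m → EvenOdd m
evenOdd zero = even 0
evenOdd (suc m) with evenOdd m
... | even e = odd e
... | odd e  = subst EvenOdd (*-suc 2 e) (even (suc e))

odd-injective : ∀ {j k} → suc (2 * j) ≡ suc (2 * k) → j ≡ k
odd-injective e = *-cancelˡ-≡ _ _ 2 (suc-injective e)

odd-prime : ∀ {p} → Prime p → p ≢ 2 → ∃[ q ] p ≡ suc (2 * q)
odd-prime {p} p-prime p≢2 with evenOdd p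
... | odd q = q , refl
... | even e with prime⇒irreducible p-prime (divides e (*-comm 2 e))
...   | inj₁ ()
...   | inj₂ 2≡p = contradiction (sym 2≡p) p≢2

coprime-*ʳ : ∀ {a b c} → Coprime a b → Coprime a c → Coprime a (b * c)
coprime-*ʳ {a} {b} a⊥b a⊥c {d} (d∣a , d∣bc) = a⊥c (d∣a , coprime-divisor d⊥b d∣bc)
  where
  d⊥b : Coprime d b
  d⊥b (e∣d , e∣b) = a⊥b (∣-trans e∣d d∣a , e∣b)

odd-coprime-2 : ∀ j → Coprime (suc (2 * j)) 2
odd-coprime-2 zero    = 1-coprimeTo 2
odd-coprime-2 (suc j) = subst (λ c → Coprime c 2) (cong suc (sym (*-suc 2 j))) (coprime-+ (odd-coprime-2 j))

coprime⇒unit : ∀ {c m} → Coprime c (suc m) → ∃[ u ] (u * c) % suc m ≡ 1 % suc m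
coprime⇒unit {c} {m} c⊥n with coprime-Bézout c⊥n
... | Bézout.+- x y eq = x , (begin
  (x * c) % suc m         ≡⟨ cong (_% suc m) eq ⟨
  (1 + y * suc m) % suc m ≡⟨ [m+kn]%n≡m%n 1 y (suc m) ⟩
  1 % suc m               ∎)
-- x c ≡ −1, so (n − 1) x inverts c
... | Bézout.-+ x y eq = m * x , (begin
  (m * x * c) % n           ≡⟨ [m+n]%n≡m%n (m * x * c) n ⟨
  (m * x * c + n) % n       ≡⟨ cong (_% n) (regroup m x c) ⟩
  suc (m * (1 + x * c)) % n ≡⟨ cong (λ z → suc (m * z) % n) eq ⟩
  suc (m * (y * n)) % n     ≡⟨ cong (λ z → suc z % n) (*-assoc m y n) ⟨
  (1 + m * y * n) % n       ≡⟨ [m+kn]%n≡m%n 1 (m * y) n ⟩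
  1 % n                     ∎)
  where
  n = suc m
  regroup : ∀ m x c → m * x * c + suc m ≡ suc (m * (1 + x * c))
  regroup = solve-∀

pm : ℕ → ℕ → ℕ → List ℕ
pm n a b = a ∷ b ∷ n ∸ a ∷ n ∸ b ∷ []

infix 4 _≡±_[mod_]

-- d = ±u in ℤ_n, with d = −u expressed as d + u = n

_≡±_[mod_] : ℕ → ℕ → ℕ → Set
d ≡± u [mod n ] = d ≡ u ⊎ d + u ≡ n

module _ {n : ℕ} where

  ≡±-unique : ∀ {d u v} → d ≡± u [mod n ] → d ≡± v [mod n ] → u ≡± v [mod n ]
  ≡±-unique (inj₁ refl) (inj₁ refl) = inj₁ refl
  ≡±-unique (inj₁ refl) (inj₂ e) = inj₂ e
  ≡±-unique {d} {u} (inj₂ e) (inj₁ refl) = inj₂ (trans (+-comm u d) e)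
  ≡±-unique {d} {u} {v} (inj₂ e) (inj₂ e′) = inj₁ (+-cancelˡ-≡ d u v (trans e (sym e′)))

  ≡±-neg : ∀ {d u} → d ≤ n → n ∸ d ≡± u [mod n ] → d ≡± u [mod n ]
  ≡±-neg d≤n (inj₁ refl) = inj₂ (m+[n∸m]≡n d≤n)
  ≡±-neg {d} {u} d≤n (inj₂ e) = inj₁ (+-cancelˡ-≡ (n ∸ d) d u (trans (m∸n+n≡m d≤n) (sym e)))

  ∈pm⇒≡± : ∀ {a b d} → a ≤ n → b ≤ n → d ∈ pm n a b → d ≡± a [mod n ] ⊎ d ≡± b [mod n ]
  ∈pm⇒≡± _ _ (here e) = inj₁ (inj₁ e)
  ∈pm⇒≡± _ _ (there (here e)) = inj₂ (inj₁ e)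
  ∈pm⇒≡± a≤n _ (there (there (here e))) = inj₁ (inj₂ (trans (cong (_+ _) e) (m∸n+n≡m a≤n)))
  ∈pm⇒≡± _ b≤n (there (there (there (here e)))) = inj₂ (inj₂ (trans (cong (_+ _) e) (m∸n+n≡m b≤n)))

  ≡±⇒∈pm : ∀ {a b d} → d ≡± a [mod n ] ⊎ d ≡± b [mod n ] → d ∈ pm n a b
  ≡±⇒∈pm (inj₁ (inj₁ e)) = here e
  ≡±⇒∈pm (inj₂ (inj₁ e)) = there (here e)
  ≡±⇒∈pm (inj₁ (inj₂ e)) = there (there (here (m+n≡o⇒m≡o∸n e)))
  ≡±⇒∈pm (inj₂ (inj₂ e)) = there (there (there (here (m+n≡o⇒m≡o∸n e))))

  pm-<n : ∀ {a b} → 0 < a → a < n → 0 < b → b < n → All (_< n) (pm n a b)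
  pm-<n 0<a a<n 0<b b<n = a<n ∷ b<n ∷ ∸-monoʳ-< 0<a (<⇒≤ a<n) ∷ ∸-monoʳ-< 0<b (<⇒≤ b<n) ∷ []

≡±-avoids : ∀ {h u d} → 0 < u → u < h + h → u ≢ h → d ≡± u [mod h + h ] → d ≢ 0 × d ≢ h
≡±-avoids 0<u _ u≢h (inj₁ refl) = >⇒≢ 0<u , u≢h
≡±-avoids {h} {u} _ u<n u≢h (inj₂ e) =
  (λ { refl → <⇒≢ u<n e }) , (λ { refl → u≢h (+-cancelˡ-≡ h u h e) })

Any-resp-⇔ : ∀ {A : Set} {P Q : A → Set} {xs} → All (λ x → P x ⇔ Q x) xs → Any P xs ⇔ Any Q xs
Any-resp-⇔ P⇔Q = mk⇔ (transport P⇔Q) (transport (All.map ⇔-sym P⇔Q))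
  where
  transport : ∀ {A : Set} {P Q : A → Set} {xs} → All (λ x → P x ⇔ Q x) xs → Any P xs → Any Q xs
  transport (e ∷ _) (here p) = here (Equivalence.to e p)
  transport (_ ∷ es) (there p) = there (transport es p)

module Modular (n : ℕ) .{{_ : NonZero n}} where

  reduce : ℕ → Fin n
  reduce a = fromℕ< (m%n<n a n)

  toℕ-reduce : ∀ a → toℕ (reduce a) ≡ a % n
  toℕ-reduce a = toℕ-fromℕ< (m%n<n a n)

  toℕ%n : ∀ (x : Fin n) → toℕ x % n ≡ toℕ x
  toℕ%n x = m<n⇒m%n≡m (toℕ<n x)

  %-absorbˡ-+ : ∀ a b → (a % n + b) % n ≡ (a + b) % n
  %-absorbˡ-+ a b = begin
    (a % n + b) % n         ≡⟨ %-distribˡ-+ (a % n) b n ⟩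
    (a % n % n + b % n) % n ≡⟨ cong (λ z → (z + b % n) % n) (m%n%n≡m%n a n) ⟩
    (a % n + b % n) % n     ≡⟨ %-distribˡ-+ a b n ⟨
    (a + b) % n             ∎

  %-absorbʳ-+ : ∀ a b → (a + b % n) % n ≡ (a + b) % n
  %-absorbʳ-+ a b = begin
    (a + b % n) % n ≡⟨ cong (_% n) (+-comm a (b % n)) ⟩
    (b % n + a) % n ≡⟨ %-absorbˡ-+ b a ⟩
    (b + a) % n     ≡⟨ cong (_% n) (+-comm b a) ⟩
    (a + b) % n     ∎

  %-absorbʳ-* : ∀ a b → (a * (b % n)) % n ≡ (a * b) % n
  %-absorbʳ-* a b = begin
    (a * (b % n)) % n         ≡⟨ %-distribˡ-* a (b % n) n ⟩
    (a % n * (b % n % n)) % n ≡⟨ cong (λ z → (a % n * z) % n) (m%n%n≡m%n b n) ⟩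
    (a % n * (b % n)) % n     ≡⟨ %-distribˡ-* a b n ⟨
    (a * b) % n               ∎

  %-absorbˡ-* : ∀ a b → (a % n * b) % n ≡ (a * b) % n
  %-absorbˡ-* a b = begin
    (a % n * b) % n ≡⟨ cong (_% n) (*-comm (a % n) b) ⟩
    (b * (a % n)) % n ≡⟨ %-absorbʳ-* b a ⟩
    (b * a) % n     ≡⟨ cong (_% n) (*-comm b a) ⟩
    (a * b) % n     ∎

  +≡*n⇒%≡∸ : ∀ {a b} m .{{_ : NonZero b}} → a + b ≡ m * n → b ≤ n → a % n ≡ n ∸ b
  +≡*n⇒%≡∸ {a} {b} zero e _ = contradiction (m+n≡0⇒n≡0 a e) (≢-nonZero⁻¹ b)
  +≡*n⇒%≡∸ {a} {b} (suc m) e b≤n = begin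
    a % n                 ≡⟨ cong (_% n) a≡ ⟩
    (n ∸ b + m * n) % n   ≡⟨ [m+kn]%n≡m%n (n ∸ b) m n ⟩
    (n ∸ b) % n           ≡⟨ m<n⇒m%n≡m (∸-monoʳ-< (>-nonZero⁻¹ b) b≤n) ⟩
    n ∸ b                 ∎
    where
    a≡ : a ≡ n ∸ b + m * n
    a≡ = begin
      a                 ≡⟨ m+n∸n≡m a b ⟨
      a + b ∸ b         ≡⟨ cong (_∸ b) e ⟩
      n + m * n ∸ b     ≡⟨ +-∸-comm (m * n) b≤n ⟩
      n ∸ b + m * n     ∎

  *-[n∸k]%n : ∀ c k .{{_ : NonZero c}} .{{_ : NonZero k}} → k * c ≤ n → (c * (n ∸ k)) % n ≡ n ∸ k * c
  *-[n∸k]%n c k kc≤n = +≡*n⇒%≡∸ c {{m*n≢0 k c}} (begin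
    c * (n ∸ k) + k * c ≡⟨ cong (c * (n ∸ k) +_) (*-comm k c) ⟩
    c * (n ∸ k) + c * k ≡⟨ *-distribˡ-+ c (n ∸ k) k ⟨
    c * (n ∸ k + k)     ≡⟨ cong (c *_) (m∸n+n≡m (≤-trans (m≤m*n k c) kc≤n)) ⟩
    c * n               ∎) kc≤n

  diff : Fin n → Fin n → ℕ
  diff x y = (toℕ y + (n ∸ toℕ x)) % n

  diff<n : ∀ x y → diff x y < n
  diff<n x y = m%n<n _ n

  +-diff : ∀ x y → (toℕ x + diff x y) % n ≡ toℕ y
  +-diff x y = begin
    (toℕ x + diff x y) % n                ≡⟨ %-absorbʳ-+ (toℕ x) _ ⟩
    (toℕ x + (toℕ y + (n ∸ toℕ x))) % n   ≡⟨ cong (_% n) (+-assoc (toℕ x) (toℕ y) _) ⟨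
    (toℕ x + toℕ y + (n ∸ toℕ x)) % n     ≡⟨ cong (_% n) (m+n+[o∸m]≡n+o (toℕ y) (<⇒≤ (toℕ<n x))) ⟩
    (toℕ y + n) % n                       ≡⟨ [m+n]%n≡m%n (toℕ y) n ⟩
    toℕ y % n                             ≡⟨ toℕ%n y ⟩
    toℕ y                                 ∎

  diff-unique : ∀ {x y d} → d < n → (toℕ x + d) % n ≡ toℕ y → diff x y ≡ d
  diff-unique {x} {y} {d} d<n e = begin
    (toℕ y + (n ∸ toℕ x)) % n             ≡⟨ cong (λ z → (z + (n ∸ toℕ x)) % n) e ⟨
    ((toℕ x + d) % n + (n ∸ toℕ x)) % n   ≡⟨ %-absorbˡ-+ (toℕ x + d) _ ⟩
    (toℕ x + d + (n ∸ toℕ x)) % n         ≡⟨ cong (_% n) (m+n+[o∸m]≡n+o d (<⇒≤ (toℕ<n x))) ⟩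
    (d + n) % n                           ≡⟨ [m+n]%n≡m%n d n ⟩
    d % n                                 ≡⟨ m<n⇒m%n≡m d<n ⟩
    d                                     ∎

  diff≡⇔ : ∀ {x y d} → d < n → diff x y ≡ d ⇔ (toℕ x + d) % n ≡ toℕ y
  diff≡⇔ {x} {y} d<n =
    mk⇔ (λ e → subst (λ d → (toℕ x + d) % n ≡ toℕ y) e (+-diff x y)) (diff-unique d<n)

  step⇒% : ∀ {x y : Fin n} {s} → y ≡ x + s [mod n ] → (toℕ x + s) % n ≡ toℕ y
  step⇒% {y = y} (inj₁ e) = trans (cong (_% n) e) (toℕ%n y)
  step⇒% {y = y} (inj₂ e) = trans (cong (_% n) e) (trans ([m+n]%n≡m%n (toℕ y) n) (toℕ%n y))

  %⇒step : ∀ {x y : Fin n} {s} → s < n → (toℕ x + s) % n ≡ toℕ y → y ≡ x + s [mod n ]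
  %⇒step {x} {y} {s} s<n e with toℕ x + s <? n
  ... | yes x+s<n = inj₁ (trans (sym (m<n⇒m%n≡m x+s<n)) e)
  ... | no x+s≮n = inj₂ (begin
    toℕ x + s         ≡⟨ m∸n+n≡m n≤x+s ⟨
    toℕ x + s ∸ n + n ≡⟨ cong (_+ n) x+s∸n≡y ⟩
    toℕ y + n         ∎)
    where
    n≤x+s = ≮⇒≥ x+s≮n
    x+s∸n≡y : toℕ x + s ∸ n ≡ toℕ y
    x+s∸n≡y = begin
      toℕ x + s ∸ n       ≡⟨ m<n⇒m%n≡m (m<n+o⇒m∸n<o (toℕ x + s) n (+-mono-< (toℕ<n x) s<n)) ⟨
      (toℕ x + s ∸ n) % n ≡⟨ m≤n⇒[n∸m]%m≡n%m n≤x+s ⟩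
      (toℕ x + s) % n     ≡⟨ e ⟩
      toℕ y               ∎

  step⇔diff : ∀ {x y : Fin n} {s} → s < n → (y ≡ x + s [mod n ]) ⇔ (diff x y ≡ s)
  step⇔diff {x} {y} s<n = mk⇔
    (λ r → diff-unique {x} {y} s<n (step⇒% {x} r))
    (λ e → %⇒step s<n (Equivalence.to (diff≡⇔ {x} {y} s<n) e))

  Cay⇔diff∈ : ∀ {S x y} → All (_< n) S → Cay n S x y ⇔ diff x y ∈ S
  Cay⇔diff∈ S<n = Any-resp-⇔ (All.map step⇔diff S<n)

  scale : ℕ → Fin n → Fin n
  scale c x = reduce (c * toℕ x)

  Unit : ℕ → Set
  Unit c = ∃[ u ] (u * c) % n ≡ 1 % n

  unit-inverse : ∀ u c → (u * c) % n ≡ 1 % n → ∀ a → (u * (c * a)) % n ≡ a % n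
  unit-inverse u c uc≡1 a = begin
    (u * (c * a)) % n     ≡⟨ cong (_% n) (*-assoc u c a) ⟨
    (u * c * a) % n       ≡⟨ %-absorbˡ-* (u * c) a ⟨
    ((u * c) % n * a) % n ≡⟨ cong (λ z → (z * a) % n) uc≡1 ⟩
    (1 % n * a) % n       ≡⟨ %-absorbˡ-* 1 a ⟩
    (1 * a) % n           ≡⟨ cong (_% n) (*-identityˡ a) ⟩
    a % n                 ∎

  scale-inverse : ∀ u c → (u * c) % n ≡ 1 % n → ∀ x → scale u (scale c x) ≡ x
  scale-inverse u c uc≡1 x = toℕ-injective (begin
    toℕ (scale u (scale c x))   ≡⟨ toℕ-reduce _ ⟩
    (u * toℕ (scale c x)) % n   ≡⟨ cong (λ z → (u * z) % n) (toℕ-reduce _) ⟩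
    (u * ((c * toℕ x) % n)) % n ≡⟨ %-absorbʳ-* u _ ⟩
    (u * (c * toℕ x)) % n       ≡⟨ unit-inverse u c uc≡1 (toℕ x) ⟩
    toℕ x % n                   ≡⟨ toℕ%n x ⟩
    toℕ x                       ∎)

  *-cancelˡ-% : ∀ {a b} c → Unit c → (c * a) % n ≡ (c * b) % n → a % n ≡ b % n
  *-cancelˡ-% {a} {b} c (u , uc≡1) e = begin
    a % n                   ≡⟨ unit-inverse u c uc≡1 a ⟨
    (u * (c * a)) % n       ≡⟨ %-absorbʳ-* u (c * a) ⟨
    (u * ((c * a) % n)) % n ≡⟨ cong (λ z → (u * z) % n) e ⟩
    (u * ((c * b) % n)) % n ≡⟨ %-absorbʳ-* u (c * b) ⟩
    (u * (c * b)) % n       ≡⟨ unit-inverse u c uc≡1 b ⟩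
    b % n                   ∎

  diff-scale : ∀ c x y → diff (scale c x) (scale c y) ≡ (c * diff x y) % n
  diff-scale c x y = diff-unique (m%n<n _ n) (begin
    (toℕ (scale c x) + (c * diff x y) % n) % n  ≡⟨ cong (λ z → (z + (c * diff x y) % n) % n) (toℕ-reduce _) ⟩
    ((c * toℕ x) % n + (c * diff x y) % n) % n  ≡⟨ %-distribˡ-+ (c * toℕ x) _ n ⟨
    (c * toℕ x + c * diff x y) % n              ≡⟨ cong (_% n) (*-distribˡ-+ c (toℕ x) _) ⟨
    (c * (toℕ x + diff x y)) % n                ≡⟨ %-absorbʳ-* c _ ⟨
    (c * ((toℕ x + diff x y) % n)) % n          ≡⟨ cong (λ z → (c * z) % n) (+-diff x y) ⟩
    (c * toℕ y) % n                             ≡⟨ toℕ-reduce _ ⟨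
    toℕ (scale c y)                             ∎)

  ∈-scale : ∀ c {S T d} → Unit c → All (_< n) S →
            Pointwise (λ s t → (c * s) % n ≡ t) S T → d < n → d ∈ S ⇔ (c * d) % n ∈ T
  ∈-scale c {d = d} c-unit S<n S~T d<n = mk⇔ (to S~T) (from S<n S~T)
    where
    to : ∀ {S T} → Pointwise (λ s t → (c * s) % n ≡ t) S T → d ∈ S → (c * d) % n ∈ T
    to (cs≡t ∷ _) (here refl) = here cs≡t
    to (_ ∷ S~T) (there d∈S) = there (to S~T d∈S)
    from : ∀ {S T} → All (_< n) S → Pointwise (λ s t → (c * s) % n ≡ t) S T → (c * d) % n ∈ T → d ∈ S
    from {s ∷ _} (s<n ∷ _) (cs≡t ∷ _) (here cd≡t) = here (begin
      d     ≡⟨ m<n⇒m%n≡m d<n ⟨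
      d % n ≡⟨ *-cancelˡ-% c c-unit (trans cd≡t (sym cs≡t)) ⟩
      s % n ≡⟨ m<n⇒m%n≡m s<n ⟩
      s     ∎)
    from (_ ∷ S<n) (_ ∷ S~T) (there cd∈T) = there (from S<n S~T cd∈T)

  Cay-scale : ∀ c {S T} → Unit c → All (_< n) S → All (_< n) T →
              Pointwise (λ s t → (c * s) % n ≡ t) S T → Cay n T ≅ Cay n S
  Cay-scale c {S} {T} (u , uc≡1) S<n T<n S~T =
    mk↔ₛ′ (scale u) (scale c) (scale-inverse u c uc≡1) (scale-inverse c u cu≡1) ,
    λ x y → Equivalence.to (T⇔S x y) , Equivalence.from (T⇔S x y)
    where
    cu≡1 : (c * u) % n ≡ 1 % n
    cu≡1 = trans (cong (_% n) (*-comm c u)) uc≡1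
    T⇔S : ∀ x y → Cay n T x y ⇔ Cay n S (scale u x) (scale u y)
    T⇔S x y = ⇔-sym (Cay⇔diff∈ S<n)
          ⇔-∘ (⇔-sym (∈-scale c (u , uc≡1) S<n S~T (diff<n (scale u x) (scale u y)))
          ⇔-∘ subst (λ d → Cay n T x y ⇔ d ∈ T) diff≡ (Cay⇔diff∈ T<n))
      where
      diff≡ : diff x y ≡ (c * diff (scale u x) (scale u y)) % n
      diff≡ = trans (sym (cong₂ diff (scale-inverse c u cu≡1 x) (scale-inverse c u cu≡1 y))) (diff-scale c _ _)

  Cay-factorisation : ∀ {k} {G H : Graph n} (S : Fin k → List ℕ) →
    (∀ i → All (_< n) (S i)) →
    (∀ x y → G x y ⇔ (∃[ i ] diff x y ∈ S i)) →
    (∀ {i j d} → d ∈ S i → d ∈ S j → i ≡ j) →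
    (∀ i → Cay n (S i) ≅ H) →
    Factorisation G H
  Cay-factorisation {k} S S<n G⇔ disjoint iso =
    k , (λ i → Cay n (S i)) , iso ,
    (λ i x y e → Equivalence.from (G⇔ x y) (i , Equivalence.to (Cay⇔diff∈ (S<n i)) e)) ,
    (λ x y g → let (i , d∈S) = Equivalence.to (G⇔ x y) g
               in i , Equivalence.from (Cay⇔diff∈ (S<n i)) d∈S) ,
    λ i j x y e f → disjoint (Equivalence.to (Cay⇔diff∈ (S<n i)) e)
                             (Equivalence.to (Cay⇔diff∈ (S<n j)) f)

  diff≡0⇔≡ : ∀ {x y} → diff x y ≡ 0 ⇔ x ≡ y
  diff≡0⇔≡ {x} {y} = mk⇔
    (λ d≡0 → toℕ-injective (trans (sym x+0%n≡x) (Equivalence.to (diff≡⇔ (>-nonZero⁻¹ n)) d≡0)))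
    (λ { refl → diff-unique (>-nonZero⁻¹ n) x+0%n≡x })
    where
    x+0%n≡x : (toℕ x + 0) % n ≡ toℕ x
    x+0%n≡x = trans (cong (_% n) (+-identityʳ (toℕ x))) (toℕ%n x)

  module _ (h : ℕ) .{{_ : NonZero h}} (h+h≡n : h + h ≡ n) where

    h<n : h < n
    h<n = subst (h <_) h+h≡n (m<m+n h (>-nonZero⁻¹ h))

    shift : Fin n → Fin n
    shift x = reduce (toℕ x + h)

    shift-involutive : ∀ x → shift (shift x) ≡ x
    shift-involutive x = toℕ-injective (begin
      toℕ (shift (shift x))       ≡⟨ toℕ-reduce _ ⟩
      (toℕ (shift x) + h) % n     ≡⟨ cong (λ z → (z + h) % n) (toℕ-reduce _) ⟩
      ((toℕ x + h) % n + h) % n   ≡⟨ %-absorbˡ-+ (toℕ x + h) h ⟩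
      (toℕ x + h + h) % n         ≡⟨ cong (_% n) (trans (+-assoc (toℕ x) h h) (cong (toℕ x +_) h+h≡n)) ⟩
      (toℕ x + n) % n             ≡⟨ [m+n]%n≡m%n (toℕ x) n ⟩
      toℕ x % n                   ≡⟨ toℕ%n x ⟩
      toℕ x                       ∎)

    diff≡h⇔shift : ∀ {x y} → diff x y ≡ h ⇔ y ≡ shift x
    diff≡h⇔shift {x} {y} = mk⇔
      (λ d≡h → toℕ-injective (trans (sym (Equivalence.to (diff≡⇔ h<n) d≡h)) (sym (toℕ-reduce _))))
      (λ { refl → diff-unique h<n (sym (toℕ-reduce _)) })

    halfTurn : PerfectMatching n
    halfTurn = record
      { mate       = shift
      ; involutive = shift-involutive
      ; no-fixed   = λ x x+h≡x → ≢-nonZero⁻¹ h (trans (sym (Equivalence.from diff≡h⇔shift (sym x+h≡x)))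
                                                   (Equivalence.from (diff≡0⇔≡ {x}) refl))
      }

    KminusI-halfTurn⇔ : ∀ x y → KminusI halfTurn x y ⇔ (diff x y ≢ 0 × diff x y ≢ h)
    KminusI-halfTurn⇔ x y = mk⇔
      (λ (x≢y , y≢x+h) → (λ d≡0 → x≢y (Equivalence.to diff≡0⇔≡ d≡0)) ,
                         (λ d≡h → y≢x+h (Equivalence.to diff≡h⇔shift d≡h)))
      (λ (d≢0 , d≢h) → (λ x≡y → d≢0 (Equivalence.from diff≡0⇔≡ x≡y)) ,
                       (λ y≡x+h → d≢h (Equivalence.from diff≡h⇔shift y≡x+h)))

module OddModulus (q : ℕ) where

  p n : ℕ
  p = suc (2 * q)
  n = p + p

  open Modular n

  odd<p : ∀ {j} → j < q → suc (2 * j) < p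
  odd<p j<q = s≤s (*-monoʳ-< 2 j<q)

  odd<n : ∀ {j} → j < q → suc (2 * j) < n
  odd<n j<q = <-≤-trans (odd<p j<q) (m≤m+n p p)

  2*odd<n : ∀ {j} → j < q → 2 * suc (2 * j) < n
  2*odd<n {j} j<q = subst (2 * suc (2 * j) <_) (2*m≡m+m p) (*-monoʳ-< 2 (odd<p j<q))

  connections : ℕ → List ℕ
  connections j = pm n (suc (2 * j)) (2 * suc (2 * j))

  connections-<n : ∀ {j} → j < q → All (_< n) (connections j)
  connections-<n j<q = pm-<n z<s (odd<n j<q) z<s (2*odd<n j<q)

  ∈connections⇒≡± : ∀ {j d} → j < q → d ∈ connections j →
    d ≡± suc (2 * j) [mod n ] ⊎ d ≡± 2 * suc (2 * j) [mod n ]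
  ∈connections⇒≡± j<q = ∈pm⇒≡± (<⇒≤ (odd<n j<q)) (<⇒≤ (2*odd<n j<q))

  ≡±-odd-odd : ∀ {j k} → j < q → k < q → suc (2 * j) ≡± suc (2 * k) [mod n ] → j ≡ k
  ≡±-odd-odd _ _ (inj₁ e) = odd-injective e
  ≡±-odd-odd j<q k<q (inj₂ e) = contradiction e (<⇒≢ (+-mono-< (odd<p j<q) (odd<p k<q)))

  odd≢±even : ∀ j c → ¬ suc (2 * j) ≡± 2 * c [mod n ]
  odd≢±even j c (inj₁ e) = even≢odd c j (sym e)
  odd≢±even j c (inj₂ e) = even≢odd p (j + c) (begin
    2 * p                  ≡⟨ 2*m≡m+m p ⟩
    p + p                  ≡⟨ e ⟨
    suc (2 * j) + 2 * c    ≡⟨ cong suc (*-distribˡ-+ 2 j c) ⟨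
    suc (2 * (j + c))      ∎)

  ≡±-even-even : ∀ j k → 2 * suc (2 * j) ≡± 2 * suc (2 * k) [mod n ] → j ≡ k
  ≡±-even-even j k (inj₁ e) = odd-injective (*-cancelˡ-≡ _ _ 2 e)
  ≡±-even-even j k (inj₂ e) = contradiction (*-cancelˡ-≡ _ _ 2 (begin
    2 * (2 * suc (j + k))             ≡⟨ regroup j k ⟩
    2 * suc (2 * j) + 2 * suc (2 * k) ≡⟨ e ⟩
    p + p                             ≡⟨ 2*m≡m+m p ⟨
    2 * p                             ∎)) (even≢odd (suc (j + k)) q)
    where
    regroup : ∀ j k → 2 * (2 * suc (j + k)) ≡ 2 * suc (2 * j) + 2 * suc (2 * k)
    regroup = solve-∀

  connections-disjoint : ∀ {j k d} → j < q → k < q → d ∈ connections j → d ∈ connections k → j ≡ k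
  connections-disjoint {j} {k} j<q k<q d∈j d∈k with ∈connections⇒≡± j<q d∈j | ∈connections⇒≡± k<q d∈k
  ... | inj₁ d±c | inj₁ d±c′ = ≡±-odd-odd j<q k<q (≡±-unique d±c d±c′)
  ... | inj₁ d±c | inj₂ d±2c′ = ⊥-elim (odd≢±even j (suc (2 * k)) (≡±-unique d±c d±2c′))
  ... | inj₂ d±2c | inj₁ d±c′ = ⊥-elim (odd≢±even k (suc (2 * j)) (≡±-unique d±c′ d±2c))
  ... | inj₂ d±2c | inj₂ d±2c′ = ≡±-even-even j k (≡±-unique d±2c d±2c′)

  connections-avoid : ∀ {j d} → j < q → d ∈ connections j → d ≢ 0 × d ≢ p
  connections-avoid {j} j<q d∈j with ∈connections⇒≡± j<q d∈j
  ... | inj₁ d±c = ≡±-avoids z<s (odd<n j<q) (<⇒≢ (odd<p j<q)) d±c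
  ... | inj₂ d±2c = ≡±-avoids z<s (2*odd<n j<q) (λ e → even≢odd (suc (2 * j)) q e) d±2c

  small-classes : ∀ {r} → 0 < r → r < p →
    ∃[ j ] j < q × (r ≡± suc (2 * j) [mod n ] ⊎ r ≡± 2 * suc (2 * j) [mod n ])
  small-classes {r} 0<r r<p with evenOdd r
  ... | odd j = j , *-cancelˡ-< 2 j q (s≤s⁻¹ r<p) , inj₁ (inj₁ refl)
  ... | even e with evenOdd e
  ...   | odd j = j , j<q , inj₂ (inj₁ refl)
    where
    j<q : j < q
    j<q = ≤-<-trans (m≤n*m j 2) (*-cancelˡ-≤ 2 (s≤s⁻¹ r<p))
  ...   | even zero = contradiction 0<r (<-irrefl refl)
  -- r = 4(i + 1) = −2c for c = p − 2(i + 1)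
  ...   | even (suc i) = j , j<q , inj₂ (inj₂ (begin
    2 * (2 * suc i) + 2 * suc (2 * j)             ≡⟨ regroup i j ⟩
    suc (2 * (suc i + j)) + suc (2 * (suc i + j)) ≡⟨ cong (λ m → suc (2 * m) + suc (2 * m)) i+j≡q ⟩
    n                                             ∎))
    where
    regroup : ∀ i j → 2 * (2 * suc i) + 2 * suc (2 * j) ≡ suc (2 * (suc i + j)) + suc (2 * (suc i + j))
    regroup = solve-∀
    i<q : suc i ≤ q
    i<q = ≤-trans (m≤n*m (suc i) 2) (*-cancelˡ-≤ 2 (s≤s⁻¹ r<p))
    j = proj₁ (m≤n⇒∃[o]m+o≡n i<q)
    i+j≡q : suc i + j ≡ q
    i+j≡q = proj₂ (m≤n⇒∃[o]m+o≡n i<q)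
    j<q : j < q
    j<q = subst (j <_) i+j≡q (m<n+m j z<s)

  classes : ∀ {d} → d < n → d ≢ 0 → d ≢ p →
    ∃[ j ] j < q × (d ≡± suc (2 * j) [mod n ] ⊎ d ≡± 2 * suc (2 * j) [mod n ])
  classes {d} d<n d≢0 d≢p with d <? p
  ... | yes d<p = small-classes (n≢0⇒n>0 d≢0) d<p
  ... | no d≮p with small-classes (m<n⇒0<n∸m d<n) n∸d<p
    where
    n∸d<p : n ∸ d < p
    n∸d<p = subst (n ∸ d <_) (m+n∸n≡m p p) (∸-monoʳ-< (≤∧≢⇒< (≮⇒≥ d≮p) (≢-sym d≢p)) (<⇒≤ d<n))
  ...   | j , j<q , cls = j , j<q , Sum.map (≡±-neg (<⇒≤ d<n)) (≡±-neg (<⇒≤ d<n)) cls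

  partition : ∀ {d} → d < n → (d ≢ 0 × d ≢ p) ⇔ (Σ[ i ∈ Fin q ] d ∈ connections (toℕ i))
  partition {d} d<n = mk⇔ cover (λ (i , d∈i) → connections-avoid (toℕ<n i) d∈i)
    where
    cover : d ≢ 0 × d ≢ p → Σ[ i ∈ Fin q ] d ∈ connections (toℕ i)
    cover (d≢0 , d≢p) with classes d<n d≢0 d≢p
    ... | j , j<q , cls =
      fromℕ< j<q , subst (λ m → d ∈ connections m) (sym (toℕ-fromℕ< j<q)) (≡±⇒∈pm cls)

  scaled-pm12 : ∀ {j} → j < q → Pointwise (λ s t → (suc (2 * j) * s) % n ≡ t) (pm12 n) (connections j)
  scaled-pm12 {j} j<q =
    trans (cong (_% n) (*-identityʳ c)) (m<n⇒m%n≡m (odd<n j<q)) ∷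
    trans (cong (_% n) (*-comm c 2)) (m<n⇒m%n≡m (2*odd<n j<q)) ∷
    trans (*-[n∸k]%n c 1 (subst (_≤ n) (sym (*-identityˡ c)) (<⇒≤ (odd<n j<q))))
          (cong (n ∸_) (*-identityˡ c)) ∷
    *-[n∸k]%n c 2 (<⇒≤ (2*odd<n j<q)) ∷ []
    where
    c = suc (2 * j)

  odd-unit : Prime p → ∀ {j} → j < q → Unit (suc (2 * j))
  odd-unit p-prime {j} j<q =
    coprime⇒unit (subst (Coprime c) (2*m≡m+m p) (coprime-*ʳ (odd-coprime-2 j) c⊥p))
    where
    c = suc (2 * j)
    c⊥p : Coprime c p
    c⊥p = Coprimality.sym (prime⇒coprime p-prime (odd<p j<q))

  factorisation : Prime p → ∃[ I ] Factorisation (KminusI {n} I) (Cay n (pm12 n))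
  factorisation p-prime = halfTurn p refl ,
    Cay-factorisation {H = Cay n (pm12 n)} (λ i → connections (toℕ i))
      (λ i → connections-<n (toℕ<n i))
      (λ x y → partition (diff<n x y) ⇔-∘ KminusI-halfTurn⇔ p refl x y)
      (λ {i} {j} d∈i d∈j → toℕ-injective (connections-disjoint (toℕ<n i) (toℕ<n j) d∈i d∈j))
      (λ i → Cay-scale (suc (2 * toℕ i)) (odd-unit p-prime (toℕ<n i))
                       (pm12-<n (toℕ<n i)) (connections-<n (toℕ<n i)) (scaled-pm12 (toℕ<n i)))
    where
    -- needs p ≥ 3, which an index j < q witnesses
    pm12-<n : ∀ {j} → j < q → All (_< n) (pm12 n)
    pm12-<n j<q = pm-<n z<s (<-trans (s≤s (s≤s z≤n)) 2<n) z<s 2<n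
      where
      2<n : 2 < n
      2<n = ≤-<-trans (*-monoʳ-≤ 2 (s≤s z≤n)) (2*odd<n j<q)

theorem9 : (p : ℕ) → Prime p → p ≢ 2 →
    ∃[ I ] Factorisation (KminusI {p + p} I) (Cay (p + p) (pm12 (p + p)))
theorem9 p p-prime p≢2 with odd-prime p-prime p≢2
... | q , refl = OddModulus.factorisation q p-prime
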